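{- Let $(A,\wedge,\vee,\rightarrow,0,1)$ be a subresiduated lattice, regarded as the srl-monoid $(A,\wedge,\vee,\wedge,\rightarrow,1)$ (product $\cdot=\wedge$, unit $e=1$). Then the strongly convex subalgebras of this srl-monoid are exactly the open lattice filters of $A$.
   Context: A subresiduated lattice is a pair $(A,Q)$ where $A$ is a bounded distributive lattice, $Q$ is a bounded sublattice of $A$, and for all $a,b\in A$ there is $c\in Q$ (denoted $a\rightarrow b$) such that for all $q\in Q$, $q\wedge a\le b$ iff $q\le c$; it is regarded as an algebra $(A,\wedge,\vee,\rightarrow,0,1)$. A commutative l-monoid is an algebra $(A,\wedge,\vee,\cdot,e)$ with $(A,\wedge,\vee)$ a lattice, $(A,\cdot,e)$ a commutative monoid, and $(a\vee b)\cdot c=(a\cdot c)\vee(b\cdot c)$. An srl-monoid is an algebra $(A,\wedge,\vee,\cdot,\rightarrow,e)$ whose reduct $(A,\wedge,\vee,\cdot,e)$ is a commutative l-monoid and for which there is a subalgebra $Q$ of that reduct such that $a\rightarrow b=\max\{q\in Q: a\cdot q\le b\}$ for all $a,b$. A convex subalgebra is a subalgebra $H$ of $(A,\wedge,\vee,\cdot,\rightarrow,e)$ such that $a,b\in H$, $a\le c\le b$ imply $c\in H$; it is strongly convex if for every $a\in A$, $h\in H$ with $a\cdot h\le e\le h\rightarrow a$ one has $a\in H$. Let $\square(a)=1\rightarrow a$. A lattice filter is a subset $H$ with $1\in H$, upward closed, and closed under $\wedge$; it is open if $\square(a)\in H$ whenever $a\in H$. -}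

module Defs where

open import Level using (Level; _⊔_; suc)
open import Relation.Binary.PropositionalEquality using (_≡_)
open import Algebra.Core using (Op₂)
open import Algebra.Lattice.Structures using (IsDistributiveLattice)
open import Data.Product using (_×_)

record SubresiduatedLattice (c q : Level) : Set (suc (c ⊔ q)) where
  infixr 6 _∧_
  infixr 5 _∨_
  infixr 4 _⇒_
  infix 3 _≤_
  field
    Carrier : Set c
    _∧_ _∨_ _⇒_ : Op₂ Carrier
    ⊥ ⊤ : Carrier
    isDistributiveLattice : IsDistributiveLattice _≡_ _∨_ _∧_
    ∧-⊤ : ∀ a → a ∧ ⊤ ≡ a
    ∨-⊥ : ∀ a → a ∨ ⊥ ≡ a
    Q : Carrier → Set q
    Q-⊥ : Q ⊥
    Q-⊤ : Q ⊤
    Q-∧ : ∀ {a b} → Q a → Q b → Q (a ∧ b)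
    Q-∨ : ∀ {a b} → Q a → Q b → Q (a ∨ b)
    Q-⇒ : ∀ a b → Q (a ⇒ b)

  _≤_ : Carrier → Carrier → Set c
  a ≤ b = a ∧ b ≡ a

  field
    residuation : ∀ a b x → Q x → ((x ∧ a ≤ b) → (x ≤ a ⇒ b)) × ((x ≤ a ⇒ b) → (x ∧ a ≤ b))

  □ : Carrier → Carrier
  □ a = ⊤ ⇒ a

record SrlSignature (c : Level) : Set (suc c) where
  field
    Carrier : Set c
    _∧_ _∨_ _·_ _⇒_ : Op₂ Carrier
    e : Carrier

  _≤_ : Carrier → Carrier → Set c
  a ≤ b = a ∧ b ≡ a

module _ {c : Level} (M : SrlSignature c) where
  open SrlSignature M

  record IsSubalgebra {h : Level} (H : Carrier → Set h) : Set (c ⊔ h) where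
    field
      e-∈ : H e
      ∧-∈ : ∀ {a b} → H a → H b → H (a ∧ b)
      ∨-∈ : ∀ {a b} → H a → H b → H (a ∨ b)
      ·-∈ : ∀ {a b} → H a → H b → H (a · b)
      ⇒-∈ : ∀ {a b} → H a → H b → H (a ⇒ b)

  record IsConvexSubalgebra {h : Level} (H : Carrier → Set h) : Set (c ⊔ h) where
    field
      isSubalgebra : IsSubalgebra H
      convex : ∀ {a b x} → H a → H b → a ≤ x → x ≤ b → H x

  record IsStronglyConvexSubalgebra {h : Level} (H : Carrier → Set h) : Set (c ⊔ h) where
    field
      isConvexSubalgebra : IsConvexSubalgebra H
      stronglyConvex : ∀ {a x} → H x → (a · x) ≤ e → e ≤ (x ⇒ a) → H a

toSrlSignature : ∀ {c q} → SubresiduatedLattice c q → SrlSignature c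
toSrlSignature L = record
  { Carrier = Carrier ; _∧_ = _∧_ ; _∨_ = _∨_ ; _·_ = _∧_ ; _⇒_ = _⇒_ ; e = ⊤ }
  where open SubresiduatedLattice L

module _ {c q : Level} (L : SubresiduatedLattice c q) where
  open SubresiduatedLattice L

  record IsOpenFilter {h : Level} (H : Carrier → Set h) : Set (c ⊔ h) where
    field
      ⊤-∈ : H ⊤
      upward : ∀ {a b} → H a → a ≤ b → H b
      ∧-∈ : ∀ {a b} → H a → H b → H (a ∧ b)
      □-∈ : ∀ {a} → H a → H (□ a)

{-# OPTIONS --safe #-}
-- With · = ∧ and e = ⊤, strong convexity says: if x ∈ H and ⊤ ≤ x ⇒ a then a ∈ H.
-- Residuation with q = ⊤ turns ⊤ ≤ x ⇒ a into x ≤ a, so on upward closed sets this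
-- condition is automatic.  Conversely an open filter is closed under a ⇒ b as soon
-- as b ∈ H, because □ b ≤ a ⇒ b; every other closure property is upward closure.
module Submission where

open import Defs
open import Level using (Level)
open import Data.Product using (_×_; _,_; proj₁; proj₂)
open import Relation.Binary.PropositionalEquality using (cong; subst; trans; module ≡-Reasoning)
open import Algebra.Lattice.Bundles using (Lattice)
open import Algebra.Lattice.Structures using (IsDistributiveLattice; IsLattice)
import Algebra.Lattice.Properties.Lattice as LatticeProperties

module SubresiduatedLatticeProperties {c q : Level} (L : SubresiduatedLattice c q) where
  open SubresiduatedLattice L
  open IsDistributiveLattice isDistributiveLattice using (isLattice)
  open IsLattice isLattice using (∧-comm; ∧-assoc; absorptive)

  private
    lattice : Lattice c c
    lattice = record { isLattice = isLattice }

  open LatticeProperties lattice using (∧-idem)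
  open ≡-Reasoning

  ≤-trans : ∀ {a b d} → a ≤ b → b ≤ d → a ≤ d
  ≤-trans {a} {b} {d} a≤b b≤d = begin
    a ∧ d        ≡⟨ cong (_∧ d) a≤b ⟨
    (a ∧ b) ∧ d  ≡⟨ ∧-assoc a b d ⟩
    a ∧ (b ∧ d)  ≡⟨ cong (a ∧_) b≤d ⟩
    a ∧ b        ≡⟨ a≤b ⟩
    a            ∎

  x∧y≤x : ∀ x y → x ∧ y ≤ x
  x∧y≤x x y = begin
    (x ∧ y) ∧ x  ≡⟨ cong (_∧ x) (∧-comm x y) ⟩
    (y ∧ x) ∧ x  ≡⟨ ∧-assoc y x x ⟩
    y ∧ (x ∧ x)  ≡⟨ cong (y ∧_) (∧-idem x) ⟩
    y ∧ x        ≡⟨ ∧-comm y x ⟩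
    x ∧ y        ∎

  x≤x∨y : ∀ x y → x ≤ x ∨ y
  x≤x∨y = proj₂ absorptive

  ⊤≤x⇒y⇒x≤y : ∀ {x y} → ⊤ ≤ x ⇒ y → x ≤ y
  ⊤≤x⇒y⇒x≤y {x} {y} ⊤≤x⇒y =
    subst (_≤ y) (trans (∧-comm ⊤ x) (∧-⊤ x)) (proj₂ (residuation x y ⊤ Q-⊤) ⊤≤x⇒y)

  □-deflationary : ∀ b → □ b ≤ b
  □-deflationary b =
    subst (_≤ b) (∧-⊤ (□ b)) (proj₂ (residuation ⊤ b (□ b) (Q-⇒ ⊤ b)) (∧-idem (□ b)))

  □≤⇒ : ∀ a b → □ b ≤ a ⇒ b
  □≤⇒ a b = proj₁ (residuation a b (□ b) (Q-⇒ ⊤ b)) (≤-trans (x∧y≤x (□ b) a) (□-deflationary b))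

module _ {c q h : Level} (L : SubresiduatedLattice c q) {H : SubresiduatedLattice.Carrier L → Set h} where
  open SubresiduatedLattice L
  open SubresiduatedLatticeProperties L

  isOpenFilter-⇒-∈ : IsOpenFilter L H → ∀ {a b} → H b → H (a ⇒ b)
  isOpenFilter-⇒-∈ F {a} {b} b∈H = upward (□-∈ b∈H) (□≤⇒ a b)
    where open IsOpenFilter F

  isStronglyConvexSubalgebra⇒isOpenFilter :
    IsStronglyConvexSubalgebra (toSrlSignature L) H → IsOpenFilter L H
  isStronglyConvexSubalgebra⇒isOpenFilter S = record
    { ⊤-∈    = e-∈
    ; upward = λ {_} {b} a∈H a≤b → convex a∈H e-∈ a≤b (∧-⊤ b)
    ; ∧-∈    = ∧-∈
    ; □-∈    = ⇒-∈ e-∈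
    }
    where
    open IsStronglyConvexSubalgebra S
    open IsConvexSubalgebra isConvexSubalgebra
    open IsSubalgebra isSubalgebra

  isOpenFilter⇒isStronglyConvexSubalgebra :
    IsOpenFilter L H → IsStronglyConvexSubalgebra (toSrlSignature L) H
  isOpenFilter⇒isStronglyConvexSubalgebra F = record
    { isConvexSubalgebra = record
      { isSubalgebra = record
        { e-∈ = ⊤-∈
        ; ∧-∈ = ∧-∈
        ; ∨-∈ = λ {a} {b} a∈H _ → upward a∈H (x≤x∨y a b)
        ; ·-∈ = ∧-∈
        ; ⇒-∈ = λ _ → isOpenFilter-⇒-∈ F
        }
      ; convex = λ a∈H _ a≤x _ → upward a∈H a≤x
      }
    ; stronglyConvex = λ x∈H _ ⊤≤x⇒a → upward x∈H (⊤≤x⇒y⇒x≤y ⊤≤x⇒a)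
    }
    where open IsOpenFilter F

proposition3p12 : ∀ {c q h : Level} (L : SubresiduatedLattice c q) (H : SubresiduatedLattice.Carrier L → Set h) → (IsStronglyConvexSubalgebra (toSrlSignature L) H → IsOpenFilter L H) × (IsOpenFilter L H → IsStronglyConvexSubalgebra (toSrlSignature L) H)
proposition3p12 L H =
  isStronglyConvexSubalgebra⇒isOpenFilter L , isOpenFilter⇒isStronglyConvexSubalgebra L
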